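{- Let $N$ be a natural number, and let $\mathcal{T}_N$ be the class of all finite reflexive graphs $G$ whose vertex set can be split into a disjoint union $G_e\cup G_c\cup G_f$ such that: the graph induced on $G_e$ is empty (no edges between distinct vertices); the graph induced on $G_c$ is complete; $|G_f|\le N$; and the connections between $G_e$ and $G_c$ are uniform, in the sense that for all $x,y\in G_e$ and all $z,t\in G_c$, $x$ is adjacent to $z$ if and only if $y$ is adjacent to $t$. Then $\mathcal{T}_N$ is well quasi-ordered under both the standard and strong homomorphic image orderings.
   Context: A graph is a digraph (set with binary edge relation) whose edge relation is symmetric; a reflexive graph has a loop $(x,x)$ at every vertex. For graphs $S,T$, a map $\phi:S\to T$ is a homomorphism if it maps edges to edges; it is strong if moreover every edge of $T$ between vertices of $\phi(S)$ is the image of some edge of $S$. Surjective (strong) homomorphisms are (strong) epimorphisms. Homomorphic image ordering: $A\preceq B$ iff there is an epimorphism $B\to A$; strong homomorphic image ordering: $A\preceq B$ iff there is a strong epimorphism $B\to A$. Well quasi-ordered means: no infinite strictly decreasing sequence and no infinite antichain. -}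

module Defs where

open import Data.Nat using (ℕ; suc; _≤_)
open import Data.Fin using (Fin)
open import Data.Bool using (Bool; true; false)
open import Data.List using (length; filter; allFin)
open import Data.Product using (Σ; ∃; ∃-syntax; _×_; proj₁)
open import Relation.Nullary using (¬_)
open import Relation.Binary.PropositionalEquality using (_≡_; _≢_)
open import Relation.Unary using (Pred)

record RGraph : Set where
  field
    size    : ℕ
    adj     : Fin size → Fin size → Bool
    adj-sym : ∀ x y → adj x y ≡ adj y x
    adj-refl : ∀ x → adj x x ≡ true
open RGraph public

Edge : (G : RGraph) → Fin (size G) → Fin (size G) → Set
Edge G x y = adj G x y ≡ true

IsHom : (S T : RGraph) → (Fin (size S) → Fin (size T)) → Set
IsHom S T φ = ∀ x y → Edge S x y → Edge T (φ x) (φ y)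

IsStrong : (S T : RGraph) → (Fin (size S) → Fin (size T)) → Set
IsStrong S T φ = ∀ x y → Edge T (φ x) (φ y) →
  ∃[ x' ] ∃[ y' ] (φ x' ≡ φ x × φ y' ≡ φ y × Edge S x' y')

Surjective : {A B : Set} → (A → B) → Set
Surjective {A} {B} φ = ∀ (b : B) → ∃[ a ] (φ a ≡ b)

Epi : (S T : RGraph) → Set
Epi S T = Σ (Fin (size S) → Fin (size T)) λ φ → IsHom S T φ × Surjective φ

StrongEpi : (S T : RGraph) → Set
StrongEpi S T = Σ (Fin (size S) → Fin (size T)) λ φ →
  IsHom S T φ × IsStrong S T φ × Surjective φ

_≼hom_ : RGraph → RGraph → Set
A ≼hom B = Epi B A

_≼strong_ : RGraph → RGraph → Set
A ≼strong B = StrongEpi B A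

data Part : Set where
  pe pc pf : Part

isF : Part → Bool
isF pf = true
isF pe = false
isF pc = false

open import Relation.Nullary.Decidable using (Dec; yes; no)
isF? : (p : Part) → Dec (isF p ≡ true)
isF? pf = yes Relation.Binary.PropositionalEquality.refl
isF? pe = no λ ()
isF? pc = no λ ()

record InT (N : ℕ) (G : RGraph) : Set where
  field
    part     : Fin (size G) → Part
    e-empty  : ∀ x y → part x ≡ pe → part y ≡ pe → x ≢ y → adj G x y ≡ false
    c-complete : ∀ x y → part x ≡ pc → part y ≡ pc → adj G x y ≡ true
    f-small  : length (filter (λ x → isF? (part x)) (allFin (size G))) ≤ N
    uniform  : ∀ x y z t → part x ≡ pe → part y ≡ pe → part z ≡ pc → part t ≡ pc →
               (Edge G x z → Edge G y t) × (Edge G y t → Edge G x z)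

𝒯 : ℕ → Set
𝒯 N = Σ RGraph (InT N)

module _ {C : Set} (_≼_ : C → C → Set) where
  _≺_ : C → C → Set
  a ≺ b = a ≼ b × ¬ (b ≼ a)

  NoInfiniteDescending : Set
  NoInfiniteDescending = ¬ (Σ (ℕ → C) λ s → ∀ i → s (suc i) ≺ s i)

  NoInfiniteAntichain : Set
  NoInfiniteAntichain =
    ¬ (Σ (ℕ → C) λ s → ∀ i j → i ≢ j → ¬ (s i ≼ s j))

  WQO : Set
  WQO = NoInfiniteDescending × NoInfiniteAntichain

HomOrder : (N : ℕ) → 𝒯 N → 𝒯 N → Set
HomOrder N A B = proj₁ A ≼hom proj₁ B

StrongOrder : (N : ℕ) → 𝒯 N → 𝒯 N → Set
StrongOrder N A B = proj₁ A ≼strong proj₁ B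

module Submission where

-- Every graph X in 𝒯_N is summarised by a finite "code":
-- fix as reference vertices the first vertex of the complete part G_c and
-- the (at most N) vertices of G_f, listed in order.  The key of a vertex
-- records its part, its adjacency to each reference vertex and whether it
-- is that reference vertex; the code of X counts the vertices of each key.
-- Whenever the code of Y is dominated by that of X (at most as many vertices
-- of every key, and none exactly when X has none), matching vertices of equal
-- keys yields a key-preserving retraction X → Y with a key-preserving
-- section, and key-preserving maps are homomorphisms; so Y is a strong
-- homomorphic image of X.  Codes are finitely many natural numbers, so by
-- the constructive Ramsey theorem (intersections of almost-full relations
-- are almost full) every infinite sequence of codes contains a dominated
-- pair i < j.  For a preorder this "good pair" property rules out infinite
-- descending chains and infinite antichains, for both orderings.

open import Defs
open import Data.Bool using (Bool; true; false)
open import Data.Bool.Properties using () renaming (_≟_ to _≟ᵇ_)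
open import Data.Empty using (⊥-elim)
open import Data.Fin using (Fin; zero; suc; inject≤; fromℕ<)
open import Data.Fin.Properties using (toℕ<n; inject≤-injective; any?) renaming (_≟_ to _≟ᶠ_)
open import Data.List as List using (List; []; _∷_; length; filter; allFin; head; cartesianProduct; cartesianProductWith)
open import Data.List.Membership.Propositional using (_∈_)
open import Data.List.Membership.Propositional.Properties
  using (∈-filter⁺; ∈-filter⁻; ∈-allFin; ∈-lookup; ∈-cartesianProduct⁺; ∈-cartesianProductWith⁺)
open import Data.List.Relation.Unary.All as All using (All; []; _∷_)
open import Data.List.Relation.Unary.Any using (here; there; index)
open import Data.List.Relation.Unary.Any.Properties using (lookup-index)
open import Data.List.Relation.Unary.AllPairs using (_∷_)
open import Data.List.Relation.Unary.Unique.Propositional using (Unique)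
open import Data.List.Relation.Unary.Unique.Propositional.Properties using (allFin⁺) renaming (filter⁺ to unique-filter⁺)
open import Data.Maybe using (Maybe; just; nothing)
open import Data.Nat using (ℕ; zero; suc; _≤_; _<_; z≤n; s≤s; s≤s⁻¹; _≡ᵇ_)
open import Data.Nat.Properties using (<⇒≢; m≤n⇒m<n∨m≡n; ≤-<-trans; ≤-trans; ≰⇒>; _≤?_)
open import Data.Product using (Σ; ∃-syntax; _×_; _,_; proj₁; proj₂; swap)
import Data.Product.Properties as Product
open import Data.Sum as Sum using (_⊎_; inj₁; inj₂)
open import Data.Vec as Vector using (Vec; []; _∷_)
import Data.Vec.Properties as Vectorₚ
open import Function using (_∘_; id)
open import Function.Definitions using (Injective)
open import Relation.Binary.Definitions using (DecidableEquality)
open import Relation.Binary.PropositionalEquality using (_≡_; refl; sym; trans; cong; module ≡-Reasoning)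
open import Relation.Nullary using (Dec; yes; no; does; contradiction)
open import Relation.Nullary.Decidable using (dec-true)

private
  variable
    A B D : Set

-- Almost-full relations (Vytiniotis–Coquand–Wahlstedt).  R ↑ a is R
-- weakened by "a is related to the first argument"; R is almost full when it
-- becomes total after finitely many such weakenings, in every order.

Rel₂ : Set → Set₁
Rel₂ A = A → A → Set

_⊆_ : Rel₂ A → Rel₂ A → Set
R ⊆ S = ∀ {x y} → R x y → S x y

_↑_ : Rel₂ A → A → Rel₂ A
(R ↑ a) x y = R x y ⊎ R a x

data AF {A : Set} : Rel₂ A → Set₁ where
  ZT  : ∀ {R} → (∀ x y → R x y) → AF R
  SUP : ∀ {R} → (∀ a → AF (R ↑ a)) → AF R

private
  variable
    R S T Q : Rel₂ A
    P P′ : Set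
    U V : A → Set

↑-mono : ∀ {a} → R ⊆ S → (R ↑ a) ⊆ (S ↑ a)
↑-mono R⊆S = Sum.map R⊆S R⊆S

af-mono : AF R → R ⊆ S → AF S
af-mono (ZT r)  R⊆S = ZT λ x y → R⊆S (r x y)
af-mono {S = S} (SUP h) R⊆S = SUP λ a → af-mono (h a) (↑-mono {S = S} R⊆S)

af-comap : (f : B → A) → AF R → AF (λ x y → R (f x) (f y))
af-comap f (ZT r)  = ZT λ x y → r (f x) (f y)
af-comap f (SUP h) = SUP λ b → af-comap f (h (f b))

Good : Rel₂ A → (ℕ → A) → Set
Good R s = ∃[ i ] ∃[ j ] (i < j × R (s i) (s j))

af-good : AF R → (s : ℕ → A) → Good R s
af-good (ZT r) s = 0 , 1 , s≤s z≤n , r (s 0) (s 1)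
af-good (SUP h) s with af-good (h (s 0)) (λ n → s (suc n))
... | i , j , i<j , inj₁ r = suc i , suc j , s≤s i<j , r
... | i , j , i<j , inj₂ r = 0 , suc i , s≤s z≤n , r

_⊕_ : Rel₂ A → Set → Rel₂ A
(R ⊕ P) x y = R x y ⊎ P

_⊕₁_ : Rel₂ A → (A → Set) → Rel₂ A
(R ⊕₁ U) x y = R x y ⊎ U x

_∩_ : Rel₂ A → Rel₂ A → Rel₂ A
(R ∩ S) x y = R x y × S x y

_∩₁_ : (A → Set) → (A → Set) → A → Set
(U ∩₁ V) x = U x × V x

⊎-pair : {C : Set} → C ⊎ P → C ⊎ P′ → C ⊎ (P × P′)
⊎-pair (inj₁ c) _        = inj₁ c
⊎-pair (inj₂ p) (inj₁ c) = inj₁ c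
⊎-pair (inj₂ p) (inj₂ q) = inj₂ (p , q)

⊕-↑ : ∀ {a} → ((R ⊕ P) ↑ a) ⊆ ((R ↑ a) ⊕ P)
⊕-↑ (inj₁ (inj₁ r)) = inj₁ (inj₁ r)
⊕-↑ (inj₁ (inj₂ p)) = inj₂ p
⊕-↑ (inj₂ (inj₁ r)) = inj₁ (inj₂ r)
⊕-↑ (inj₂ (inj₂ p)) = inj₂ p

↑-⊕ : ∀ {a} → ((R ↑ a) ⊕ P) ⊆ ((R ⊕ P) ↑ a)
↑-⊕ (inj₁ (inj₁ r)) = inj₁ (inj₁ r)
↑-⊕ (inj₁ (inj₂ r)) = inj₂ (inj₁ r)
↑-⊕ (inj₂ p)        = inj₁ (inj₂ p)

⊕₁-↑ : ∀ {a} → ((R ⊕₁ U) ↑ a) ⊆ (((R ↑ a) ⊕ U a) ⊕₁ U)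
⊕₁-↑ (inj₁ (inj₁ r)) = inj₁ (inj₁ (inj₁ r))
⊕₁-↑ (inj₁ (inj₂ u)) = inj₂ u
⊕₁-↑ (inj₂ (inj₁ r)) = inj₁ (inj₁ (inj₂ r))
⊕₁-↑ (inj₂ (inj₂ u)) = inj₁ (inj₂ u)

↑-⊕₁ : ∀ {a} → (((R ↑ a) ⊕₁ U) ⊕ U a) ⊆ ((R ⊕₁ U) ↑ a)
↑-⊕₁ (inj₁ (inj₁ (inj₁ r))) = inj₁ (inj₁ r)
↑-⊕₁ (inj₁ (inj₁ (inj₂ r))) = inj₂ (inj₁ r)
↑-⊕₁ (inj₁ (inj₂ u))        = inj₁ (inj₂ u)
↑-⊕₁ (inj₂ u)               = inj₂ (inj₂ u)

⊕₁-⊕-comm : ((R ⊕ P) ⊕₁ U) ⊆ ((R ⊕₁ U) ⊕ P)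
⊕₁-⊕-comm (inj₁ (inj₁ r)) = inj₁ (inj₁ r)
⊕₁-⊕-comm (inj₁ (inj₂ p)) = inj₂ p
⊕₁-⊕-comm (inj₂ u)        = inj₁ (inj₂ u)

af-⊕-total : (∀ x y → (R ⊕ P) x y) → AF T → T ⊆ (R ⊕ P′) → AF (R ⊕ (P × P′))
af-⊕-total r (ZT t) T⊆ = ZT λ x y → ⊎-pair (r x y) (T⊆ (t x y))
af-⊕-total {R = R} {P′ = P′} r (SUP h) T⊆ = SUP λ a →
  af-mono (af-⊕-total {R = R ↑ a} (λ x y → Sum.map₁ inj₁ (r x y)) (h a)
                      (⊕-↑ {R = R} ∘ ↑-mono {S = R ⊕ P′} T⊆))
          (↑-⊕ {R = R})

af-⊕ : AF S → AF T → S ⊆ (R ⊕ P) → T ⊆ (R ⊕ P′) → AF (R ⊕ (P × P′))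
af-⊕ (ZT s) t S⊆ T⊆ = af-⊕-total (λ x y → S⊆ (s x y)) t T⊆
af-⊕ {R = R} {P = P} (SUP h) t S⊆ T⊆ = SUP λ a →
  af-mono (af-⊕ {R = R ↑ a} (h a) t (⊕-↑ {R = R} ∘ ↑-mono {S = R ⊕ P} S⊆)
                (Sum.map₁ inj₁ ∘ T⊆))
          (↑-⊕ {R = R})

af-⊕₁-total : (∀ x y → (R ⊕₁ U) x y) → AF T → T ⊆ (R ⊕₁ V) → AF (R ⊕₁ (U ∩₁ V))
af-⊕₁-total r (ZT t) T⊆ = ZT λ x y → ⊎-pair (r x y) (T⊆ (t x y))
af-⊕₁-total {R = R} {U = U} {V = V} r (SUP h) T⊆ = SUP λ a →
  af-mono (af-⊕₁-total {R = (R ↑ a) ⊕ V a} (λ x y → Sum.map₁ (inj₁ ∘ inj₁) (r x y)) (h a)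
                       (⊕₁-↑ {R = R} ∘ ↑-mono {S = R ⊕₁ V} T⊆))
          (lift a)
  where
  -- the witness V a left over by ⊕₁-↑ is completed using totality of R ⊕₁ U
  lift : ∀ a → (((R ↑ a) ⊕ V a) ⊕₁ (U ∩₁ V)) ⊆ ((R ⊕₁ (U ∩₁ V)) ↑ a)
  lift a (inj₁ (inj₁ (inj₁ r′))) = inj₁ (inj₁ r′)
  lift a (inj₁ (inj₁ (inj₂ r′))) = inj₂ (inj₁ r′)
  lift a {x} (inj₁ (inj₂ v))     = inj₂ (Sum.map₂ (_, v) (r a x))
  lift a (inj₂ uv)               = inj₁ (inj₂ uv)

af-⊕₁ : AF S → AF T → S ⊆ (R ⊕₁ U) → T ⊆ (R ⊕₁ V) → AF (R ⊕₁ (U ∩₁ V))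
af-⊕₁ (ZT s) t S⊆ T⊆ = af-⊕₁-total (λ x y → S⊆ (s x y)) t T⊆
af-⊕₁ {V = V} (SUP h) (ZT t) S⊆ T⊆ =
  af-mono (af-⊕₁-total {U = V} (λ x y → T⊆ (t x y)) (SUP h) S⊆) (Sum.map₂ swap)
af-⊕₁ {R = R} {U = U} {V = V} (SUP h) (SUP k) S⊆ T⊆ = SUP λ a →
  af-mono (af-⊕ {R = (R ↑ a) ⊕₁ (U ∩₁ V)}
            (af-mono (af-⊕₁ (h a) (SUP k)
                        (⊕₁-↑ {R = R} ∘ ↑-mono {S = R ⊕₁ U} S⊆)
                        (Sum.map₁ (inj₁ ∘ inj₁) ∘ T⊆))
                     (⊕₁-⊕-comm {R = R ↑ a} {U = U ∩₁ V}))
            (af-mono (af-⊕₁ (SUP h) (k a)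
                        (Sum.map₁ (inj₁ ∘ inj₁) ∘ S⊆)
                        (⊕₁-↑ {R = R} ∘ ↑-mono {S = R ⊕₁ V} T⊆))
                     (⊕₁-⊕-comm {R = R ↑ a} {U = U ∩₁ V}))
            id id)
          (↑-⊕₁ {R = R})

-- Intersection of almost-full relations (the constructive Ramsey theorem),
-- first up to inclusions so that the induction can weaken the relations.
af-∩-⊆ : AF S → AF T → S ⊆ R → T ⊆ Q → AF (R ∩ Q)
af-∩-⊆ (ZT s) t S⊆ T⊆ = af-mono t λ q → S⊆ (s _ _) , T⊆ q
af-∩-⊆ (SUP h) (ZT t) S⊆ T⊆ = af-mono (SUP h) λ r → S⊆ r , T⊆ (t _ _)
af-∩-⊆ {R = R} {Q = Q} (SUP h) (SUP k) S⊆ T⊆ = SUP λ a →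
  af-⊕₁ {R = R ∩ Q}
    (af-∩-⊆ (h a) (SUP k) (↑-mono {S = R} S⊆) T⊆)
    (af-∩-⊆ (SUP h) (k a) S⊆ (↑-mono {S = Q} T⊆))
    split-left split-right
  where
  split-left : ∀ {a} → ((R ↑ a) ∩ Q) ⊆ ((R ∩ Q) ⊕₁ R a)
  split-left (inj₁ r , q) = inj₁ (r , q)
  split-left (inj₂ r , _) = inj₂ r
  split-right : ∀ {a} → (R ∩ (Q ↑ a)) ⊆ ((R ∩ Q) ⊕₁ Q a)
  split-right (r , inj₁ q) = inj₁ (r , q)
  split-right (_ , inj₂ q) = inj₂ q

af-∩ : AF R → AF Q → AF (R ∩ Q)
af-∩ r q = af-∩-⊆ r q id id

-- Equality on Bool is almost full: among any three booleans two agree.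
af-≡-Bool : AF {Bool} _≡_
af-≡-Bool = SUP λ a → SUP λ b → after a b
  where
  after : ∀ a b → AF ((_≡_ ↑ a) ↑ b)
  after false false = ZT λ _ _ → inj₂ (inj₂ refl)
  after true  true  = ZT λ _ _ → inj₂ (inj₂ refl)
  after false true  = ZT λ { false _ → inj₁ (inj₂ refl) ; true _ → inj₂ (inj₁ refl) }
  after true  false = ZT λ { true _ → inj₁ (inj₂ refl) ; false _ → inj₂ (inj₁ refl) }

af-≤-or-above : ∀ n → AF {ℕ} (λ x y → x ≤ y ⊎ n ≤ x)
af-≤-or-above zero    = ZT λ _ _ → inj₂ z≤n
af-≤-or-above (suc n) = SUP after
  where
  after : ∀ a → AF ((λ x y → x ≤ y ⊎ suc n ≤ x) ↑ a)
  after a with suc n ≤? a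
  ... | yes n<a = ZT λ _ _ → inj₂ (inj₂ n<a)
  ... | no  n≮a = af-mono (af-≤-or-above n)
                    (Sum.map inj₁ λ n≤x → inj₁ (≤-trans (s≤s⁻¹ (≰⇒> n≮a)) n≤x))

af-≤ : AF _≤_
af-≤ = SUP af-≤-or-above

_⊑_ : ℕ → ℕ → Set
a ⊑ b = a ≤ b × (a ≡ᵇ 0) ≡ (b ≡ᵇ 0)

af-⊑ : AF _⊑_
af-⊑ = af-∩ af-≤ (af-comap (_≡ᵇ 0) af-≡-Bool)

⊑-positive : ∀ {a b} → a ⊑ b → 0 < b → 0 < a
⊑-positive {zero} {suc b} (_ , ()) _
⊑-positive {suc a} _ _ = s≤s z≤n

Enumeration : Set → Set
Enumeration D = Σ (List D) λ ds → ∀ d → d ∈ ds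

enum-Bool : Enumeration Bool
enum-Bool = true ∷ false ∷ [] , λ { true → here refl ; false → there (here refl) }

enum-× : Enumeration A → Enumeration B → Enumeration (A × B)
enum-× (as , a∈) (bs , b∈) = cartesianProduct as bs , λ (a , b) → ∈-cartesianProduct⁺ (a∈ a) (b∈ b)

enum-Vec : Enumeration A → ∀ n → Enumeration (Vec A n)
enum-Vec _ zero = [] ∷ [] , λ { [] → here refl }
enum-Vec (as , a∈) (suc n) =
  let vs , v∈ = enum-Vec (as , a∈) n in
  cartesianProductWith _∷_ as vs , λ { (a ∷ v) → ∈-cartesianProductWith⁺ _∷_ (a∈ a) (v∈ v) }

af-All : (ds : List D) → AF R → AF (λ (f g : D → A) → All (λ d → R (f d) (g d)) ds)
af-All []       _  = ZT λ _ _ → []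
af-All (d ∷ ds) af = af-mono (af-∩ (af-comap (λ f → f d) af) (af-All ds af)) λ (r , rs) → r ∷ rs

af-pointwise : Enumeration D → AF R → AF (λ (f g : D → A) → ∀ d → R (f d) (g d))
af-pointwise (ds , d∈) af = af-mono (af-All ds af) λ rs d → All.lookup rs (d∈ d)

lookup-injective : {xs : List A} → Unique xs → ∀ {i j} → List.lookup xs i ≡ List.lookup xs j → i ≡ j
lookup-injective {xs = _ ∷ _} _ {zero} {zero} _ = refl
lookup-injective (x∉ ∷ _) {zero} {suc j} eq = ⊥-elim (All.lookup x∉ (∈-lookup j) eq)
lookup-injective (x∉ ∷ _) {suc i} {zero} eq = ⊥-elim (All.lookup x∉ (∈-lookup i) (sym eq))
lookup-injective (_ ∷ u) {suc i} {suc j} eq = cong suc (lookup-injective u eq)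

module Fibres {K : Set} (_≟_ : DecidableEquality K) {n : ℕ} (κ : Fin n → K) where

  fibre : K → List (Fin n)
  fibre k = filter (λ x → κ x ≟ k) (allFin n)

  count : K → ℕ
  count k = length (fibre k)

  member : (k : K) → Fin (count k) → Fin n
  member k = List.lookup (fibre k)

  member-key : ∀ k i → κ (member k i) ≡ k
  member-key k i = proj₂ (∈-filter⁻ (λ x → κ x ≟ k) {xs = allFin n} (∈-lookup i))

  member-injective : ∀ k {i j} → member k i ≡ member k j → i ≡ j
  member-injective k = lookup-injective (unique-filter⁺ (λ x → κ x ≟ k) (allFin⁺ n))

  position : (x : Fin n) → Fin (count (κ x))
  position x = index (∈-filter⁺ (λ y → κ y ≟ κ x) (∈-allFin x) refl)

  member-position : ∀ x → member (κ x) (position x) ≡ x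
  member-position x = sym (lookup-index (∈-filter⁺ (λ y → κ y ≟ κ x) (∈-allFin x) refl))

  inhabited : ∀ x → 0 < count (κ x)
  inhabited x = ≤-<-trans z≤n (toℕ<n (position x))

module Retraction {m n : ℕ} (σ : Fin m → Fin n) (σ-injective : Injective _≡_ _≡_ σ)
                  (fallback : Fin n → Fin m) where

  private
    pick : (x : Fin n) → Dec (∃[ y ] σ y ≡ x) → Fin m
    pick x (yes (y , _)) = y
    pick x (no _)        = fallback x

  retract : Fin n → Fin m
  retract x = pick x (any? λ y → σ y ≟ᶠ x)

  retract-section : ∀ y → retract (σ y) ≡ y
  retract-section y = pick-σ (any? λ y′ → σ y′ ≟ᶠ σ y)
    where
    pick-σ : (d : Dec (∃[ y′ ] σ y′ ≡ σ y)) → pick (σ y) d ≡ y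
    pick-σ (yes (_ , eq)) = σ-injective eq
    pick-σ (no ∄)         = contradiction (y , refl) ∄

  retract-cases : ∀ x → σ (retract x) ≡ x ⊎ retract x ≡ fallback x
  retract-cases x = pick-cases (any? λ y → σ y ≟ᶠ x)
    where
    pick-cases : (d : Dec (∃[ y ] σ y ≡ x)) → σ (pick x d) ≡ x ⊎ pick x d ≡ fallback x
    pick-cases (yes (_ , eq)) = inj₁ eq
    pick-cases (no _)         = inj₂ refl

record Matching {K : Set} {m n : ℕ} (κX : Fin n → K) (κY : Fin m → K) : Set where
  field
    forth      : Fin n → Fin m
    back       : Fin m → Fin n
    forth-key  : ∀ x → κY (forth x) ≡ κX x
    back-key   : ∀ y → κX (back y) ≡ κY y
    forth-back : ∀ y → forth (back y) ≡ y

-- Matching lemma: if every fibre of κY is at most as large as the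
-- corresponding fibre of κX, and empty only when it is, a matching exists.
-- back sends the i-th element of a fibre of κY to the i-th element of the
-- same fibre of κX; forth inverts it, sending the rest into the right fibre.
matching : {K : Set} (_≟_ : DecidableEquality K) {m n : ℕ} (κX : Fin n → K) (κY : Fin m → K) →
           (∀ k → Fibres.count _≟_ κY k ⊑ Fibres.count _≟_ κX k) → Matching κX κY
matching _≟_ κX κY below = record
  { forth = retract ; back = back ; forth-key = forth-key
  ; back-key = λ y → X.member-key (κY y) _ ; forth-back = retract-section }
  where
  module X = Fibres _≟_ κX
  module Y = Fibres _≟_ κY

  slot : ∀ k → Fin (Y.count k) → Fin _
  slot k i = X.member k (inject≤ i (proj₁ (below k)))

  back : Fin _ → Fin _
  back y = slot (κY y) (Y.position y)

  same-slot : ∀ {k k′} (i : Fin (Y.count k)) (j : Fin (Y.count k′)) →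
              slot k i ≡ slot k′ j → Y.member k i ≡ Y.member k′ j
  same-slot {k} {k′} i j eq with trans (sym (X.member-key k _)) (trans (cong κX eq) (X.member-key k′ _))
  ... | refl = cong (Y.member k) (inject≤-injective _ _ i j (X.member-injective k eq))

  back-injective : Injective _≡_ _≡_ back
  back-injective {y} {y′} eq = begin
    y                                   ≡⟨ sym (Y.member-position y) ⟩
    Y.member (κY y) (Y.position y)      ≡⟨ same-slot (Y.position y) (Y.position y′) eq ⟩
    Y.member (κY y′) (Y.position y′)    ≡⟨ Y.member-position y′ ⟩
    y′                                  ∎
    where open ≡-Reasoning

  fallback : Fin _ → Fin _
  fallback x = Y.member (κX x) (fromℕ< (⊑-positive (below (κX x)) (X.inhabited x)))

  open Retraction back back-injective fallback

  forth-key : ∀ x → κY (retract x) ≡ κX x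
  forth-key x with retract-cases x
  ... | inj₁ back-forth-x≡x = trans (sym (X.member-key (κY (retract x)) _)) (cong κX back-forth-x≡x)
  ... | inj₂ forth-x≡fallback = trans (cong κY forth-x≡fallback) (Y.member-key (κX x) _)

_≟ₚ_ : DecidableEquality Part
pe ≟ₚ pe = yes refl
pc ≟ₚ pc = yes refl
pf ≟ₚ pf = yes refl
pe ≟ₚ pc = no λ ()
pe ≟ₚ pf = no λ ()
pc ≟ₚ pe = no λ ()
pc ≟ₚ pf = no λ ()
pf ≟ₚ pe = no λ ()
pf ≟ₚ pc = no λ ()

enum-Part : Enumeration Part
enum-Part = pe ∷ pc ∷ pf ∷ [] , λ { pe → here refl ; pc → there (here refl) ; pf → there (there (here refl)) }

-- The key of a vertex: its part, its adjacency to each of the N + 1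
-- reference vertices, and which reference vertex it is.
Key : ℕ → Set
Key N = Part × Vec Bool (suc N) × Vec Bool (suc N)

_≟ᴷ_ : ∀ {N} → DecidableEquality (Key N)
_≟ᴷ_ = Product.≡-dec _≟ₚ_ (Product.≡-dec (Vectorₚ.≡-dec _≟ᵇ_) (Vectorₚ.≡-dec _≟ᵇ_))

enum-Key : ∀ N → Enumeration (Key N)
enum-Key N = enum-× enum-Part (enum-× (enum-Vec enum-Bool (suc N)) (enum-Vec enum-Bool (suc N)))

pad : ∀ n → List A → Vec (Maybe A) n
pad zero    _        = []
pad (suc n) []       = nothing ∷ pad n []
pad (suc n) (x ∷ xs) = just x ∷ pad n xs

pad-∈ : ∀ {n x} {xs : List A} → x ∈ xs → length xs ≤ n → ∃[ k ] Vector.lookup (pad n xs) k ≡ just x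
pad-∈ {n = suc n} (here refl) _        = zero , refl
pad-∈ {n = suc n} (there x∈)  (s≤s le) = let k , eq = pad-∈ x∈ le in suc k , eq

head-∈ : ∀ {x} {xs : List A} → x ∈ xs → ∃[ y ] (head xs ≡ just y × y ∈ xs)
head-∈ (here _)  = _ , refl , here refl
head-∈ (there _) = _ , refl , here refl

isAt : ∀ {n} → Fin n → Maybe (Fin n) → Bool
isAt x nothing  = false
isAt x (just r) = does (r ≟ᶠ x)

isAt-self : ∀ {n} (x : Fin n) → isAt x (just x) ≡ true
isAt-self x = dec-true (x ≟ᶠ x) refl

isAt-sound : ∀ {n} {x : Fin n} r → isAt x r ≡ true → r ≡ just x
isAt-sound {x = x} (just r) eq with r ≟ᶠ x
... | yes refl = refl

edge-sym : ∀ G {x y} → Edge G x y → Edge G y x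
edge-sym G {x} {y} e = trans (adj-sym G y x) e

module Keys {N : ℕ} (X : 𝒯 N) where

  G : RGraph
  G = proj₁ X

  open InT (proj₂ X) public

  Vertex : Set
  Vertex = Fin (size G)

  fVertices cVertices : List Vertex
  fVertices = filter (λ x → isF? (part x)) (allFin (size G))
  cVertices = filter (λ x → part x ≟ₚ pc) (allFin (size G))

  refs : Vec (Maybe Vertex) (suc N)
  refs = head cVertices ∷ pad N fVertices

  ref : Fin (suc N) → Maybe Vertex
  ref = Vector.lookup refs

  adjTo : Vertex → Maybe Vertex → Bool
  adjTo x nothing  = false
  adjTo x (just r) = adj G x r

  key : Vertex → Key N
  key x = part x , Vector.map (adjTo x) refs , Vector.map (isAt x) refs

  code : Key N → ℕ
  code = Fibres.count _≟ᴷ_ key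

  f-ref : ∀ {a} → part a ≡ pf → ∃[ i ] ref i ≡ just a
  f-ref {a} pa =
    let k , eq = pad-∈ (∈-filter⁺ (λ x → isF? (part x)) (∈-allFin a) (cong isF pa)) f-small
    in suc k , eq

  c-ref : ∀ {z} → part z ≡ pc → ∃[ c ] (ref zero ≡ just c × part c ≡ pc)
  c-ref {z} pz =
    let c , eq , c∈ = head-∈ (∈-filter⁺ (λ x → part x ≟ₚ pc) (∈-allFin z) pz)
    in c , eq , proj₂ (∈-filter⁻ (λ x → part x ≟ₚ pc) {xs = allFin (size G)} c∈)

module KeyPreserving {N : ℕ} (X Y : 𝒯 N) (φ : Keys.Vertex X → Keys.Vertex Y)
                     (φ-key : ∀ x → Keys.key Y (φ x) ≡ Keys.key X x) where

  private
    module X = Keys X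
    module Y = Keys Y
  open ≡-Reasoning
  open Vector using (lookup; map)
  open Vectorₚ using (lookup-map)

  part-φ : ∀ x → Y.part (φ x) ≡ X.part x
  part-φ x = cong proj₁ (φ-key x)

  adjTo-φ : ∀ x i → Y.adjTo (φ x) (Y.ref i) ≡ X.adjTo x (X.ref i)
  adjTo-φ x i = begin
    Y.adjTo (φ x) (Y.ref i)                ≡⟨ sym (lookup-map i _ Y.refs) ⟩
    lookup (map (Y.adjTo (φ x)) Y.refs) i  ≡⟨ cong (λ κ → lookup (proj₁ (proj₂ κ)) i) (φ-key x) ⟩
    lookup (map (X.adjTo x) X.refs) i      ≡⟨ lookup-map i _ X.refs ⟩
    X.adjTo x (X.ref i)                    ∎

  isAt-φ : ∀ x i → isAt (φ x) (Y.ref i) ≡ isAt x (X.ref i)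
  isAt-φ x i = begin
    isAt (φ x) (Y.ref i)                ≡⟨ sym (lookup-map i _ Y.refs) ⟩
    lookup (map (isAt (φ x)) Y.refs) i  ≡⟨ cong (λ κ → lookup (proj₂ (proj₂ κ)) i) (φ-key x) ⟩
    lookup (map (isAt x) X.refs) i      ≡⟨ lookup-map i _ X.refs ⟩
    isAt x (X.ref i)                    ∎

  ref-φ : ∀ {a} i → X.ref i ≡ just a → Y.ref i ≡ just (φ a)
  ref-φ {a} i eq = isAt-sound (Y.ref i) (begin
    isAt (φ a) (Y.ref i)  ≡⟨ isAt-φ a i ⟩
    isAt a (X.ref i)      ≡⟨ cong (isAt a) eq ⟩
    isAt a (just a)       ≡⟨ isAt-self a ⟩
    true                  ∎)

  edge-to-ref : ∀ {a x} i → X.ref i ≡ just a → Edge X.G x a → Edge Y.G (φ x) (φ a)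
  edge-to-ref {a} {x} i eq e = begin
    adj Y.G (φ x) (φ a)      ≡⟨ cong (Y.adjTo (φ x)) (sym (ref-φ i eq)) ⟩
    Y.adjTo (φ x) (Y.ref i)  ≡⟨ adjTo-φ x i ⟩
    X.adjTo x (X.ref i)      ≡⟨ cong (X.adjTo x) eq ⟩
    adj X.G x a              ≡⟨ e ⟩
    true                     ∎

  -- every vertex of G_f is a reference vertex
  edge-to-F : ∀ {x a} → X.part a ≡ pf → Edge X.G x a → Edge Y.G (φ x) (φ a)
  edge-to-F pa = let i , ref-a = X.f-ref pa in edge-to-ref i ref-a

  -- between G_e and G_c, adjacency is decided by the first vertex c of G_c
  edge-E-C : ∀ {x z} → X.part x ≡ pe → X.part z ≡ pc → Edge X.G x z → Edge Y.G (φ x) (φ z)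
  edge-E-C {x} {z} px pz e =
    let c , ref-c , pcc = X.c-ref pz
        pφx = trans (part-φ x) px
    in proj₂ (Y.uniform (φ x) (φ x) (φ z) (φ c) pφx pφx (trans (part-φ z) pz) (trans (part-φ c) pcc))
             (edge-to-ref zero ref-c (proj₁ (X.uniform x x z c px px pz pcc) e))

  -- G_e carries no edges besides loops
  edge-E-E : ∀ {x y} → X.part x ≡ pe → X.part y ≡ pe → Edge X.G x y → Edge Y.G (φ x) (φ y)
  edge-E-E {x} {y} px py e with x ≟ᶠ y
  ... | yes refl = adj-refl Y.G (φ x)
  ... | no x≢y   = contradiction (trans (sym e) (X.e-empty x y px py x≢y)) λ ()

  hom : IsHom X.G Y.G φ
  hom x y e with X.part x in px | X.part y in py
  ... | _  | pf = edge-to-F py e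
  ... | pf | _  = edge-sym Y.G (edge-to-F px (edge-sym X.G e))
  ... | pe | pe = edge-E-E px py e
  ... | pc | pc = Y.c-complete (φ x) (φ y) (trans (part-φ x) px) (trans (part-φ y) py)
  ... | pe | pc = edge-E-C px py e
  ... | pc | pe = edge-sym Y.G (edge-E-C py px (edge-sym X.G e))

-- A matching of keys yields a strong epimorphism: forth is a homomorphism,
-- and every edge between images is the image of an edge via back.
matching-strong-epi : ∀ {N} (X Y : 𝒯 N) → Matching (Keys.key X) (Keys.key Y) →
                      StrongEpi (proj₁ X) (proj₁ Y)
matching-strong-epi X Y M = forth , KeyPreserving.hom X Y forth forth-key , strong , λ y → back y , forth-back y
  where
  open Matching M

  back-hom : IsHom (proj₁ Y) (proj₁ X) back
  back-hom = KeyPreserving.hom Y X back back-key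

  strong : IsStrong (proj₁ X) (proj₁ Y) forth
  strong x y e = back (forth x) , back (forth y) , forth-back _ , forth-back _ , back-hom _ _ e

code-strong-epi : ∀ {N} (X Y : 𝒯 N) → (∀ k → Keys.code Y k ⊑ Keys.code X k) →
                  proj₁ Y ≼strong proj₁ X
code-strong-epi X Y below = matching-strong-epi X Y (matching _≟ᴷ_ (Keys.key X) (Keys.key Y) below)

module _ {A B C : RGraph} where

  onto-∘ : {φ : Fin (size A) → Fin (size B)} {χ : Fin (size B) → Fin (size C)} →
           Surjective φ → Surjective χ → Surjective (χ ∘ φ)
  onto-∘ {χ = χ} φ-onto χ-onto c =
    let b , χb≡c = χ-onto c
        a , φa≡b = φ-onto b
    in a , trans (cong χ φa≡b) χb≡c

  epi-∘ : Epi A B → Epi B C → Epi A C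
  epi-∘ (φ , φ-hom , φ-onto) (χ , χ-hom , χ-onto) =
    χ ∘ φ , (λ x y e → χ-hom _ _ (φ-hom x y e)) , onto-∘ φ-onto χ-onto

  strongEpi-∘ : StrongEpi A B → StrongEpi B C → StrongEpi A C
  strongEpi-∘ (φ , φ-hom , φ-strong , φ-onto) (χ , χ-hom , χ-strong , χ-onto) =
    χ ∘ φ , (λ x y e → χ-hom _ _ (φ-hom x y e)) , strong , onto-∘ φ-onto χ-onto
    where
    strong : IsStrong A C (χ ∘ φ)
    strong x y e with χ-strong (φ x) (φ y) e
    ... | b , b′ , χb , χb′ , eb with φ-onto b | φ-onto b′
    ... | a , refl | a′ , refl with φ-strong a a′ eb
    ... | x′ , y′ , φx′ , φy′ , e′ = x′ , y′ , trans (cong χ φx′) χb , trans (cong χ φy′) χb′ , e′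

strongEpi-id : ∀ {A} → StrongEpi A A
strongEpi-id = id , (λ _ _ e → e) , (λ x y e → x , y , refl , refl , e) , λ b → b , refl

strongEpi⇒epi : ∀ {A B} → StrongEpi A B → Epi A B
strongEpi⇒epi (φ , φ-hom , _ , φ-onto) = φ , φ-hom , φ-onto

module _ {N : ℕ} where

  hom-refl : ∀ {a : 𝒯 N} → HomOrder N a a
  hom-refl {a} = strongEpi⇒epi {proj₁ a} {proj₁ a} (strongEpi-id {proj₁ a})

  hom-trans : ∀ {a b c : 𝒯 N} → HomOrder N a b → HomOrder N b c → HomOrder N a c
  hom-trans {a} {b} {c} a≼b b≼c = epi-∘ {proj₁ c} {proj₁ b} {proj₁ a} b≼c a≼b

  strong-refl : ∀ {a : 𝒯 N} → StrongOrder N a a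
  strong-refl {a} = strongEpi-id {proj₁ a}

  strong-trans : ∀ {a b c : 𝒯 N} → StrongOrder N a b → StrongOrder N b c → StrongOrder N a c
  strong-trans {a} {b} {c} a≼b b≼c = strongEpi-∘ {proj₁ c} {proj₁ b} {proj₁ a} b≼c a≼b

  strong⇒hom : ∀ {a b : 𝒯 N} → StrongOrder N a b → HomOrder N a b
  strong⇒hom {a} {b} = strongEpi⇒epi {proj₁ b} {proj₁ a}

module _ {C : Set} (_≼_ : C → C → Set)
         (≼-refl : ∀ {a} → a ≼ a) (≼-trans : ∀ {a b c} → a ≼ b → b ≼ c → a ≼ c) where

  wqo-from-good : (∀ s → Good _≼_ s) → WQO _≼_
  wqo-from-good good = no-descent , no-antichain
    where
    no-descent : NoInfiniteDescending _≼_
    no-descent (s , desc) =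
      let i , j , i<j , sᵢ≼sⱼ = good s in proj₂ (desc i) (≼-trans sᵢ≼sⱼ (descends i<j))
      where
      descends : ∀ {m n} → m ≤ n → s n ≼ s m
      descends {n = zero} z≤n = ≼-refl
      descends {n = suc n} m≤1+n with m≤n⇒m<n∨m≡n m≤1+n
      ... | inj₁ m<1+n = ≼-trans (proj₁ (desc n)) (descends (s≤s⁻¹ m<1+n))
      ... | inj₂ refl  = ≼-refl

    no-antichain : NoInfiniteAntichain _≼_
    no-antichain (s , incomparable) =
      let i , j , i<j , sᵢ≼sⱼ = good s in incomparable i j (<⇒≢ i<j) sᵢ≼sⱼ

-- Every sequence in 𝒯_N has a strong image pair: codes are almost full.
strong-good : ∀ N (s : ℕ → 𝒯 N) → Good (StrongOrder N) s
strong-good N s =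
  let i , j , i<j , below = af-good (af-comap Keys.code (af-pointwise (enum-Key N) af-⊑)) s
  in i , j , i<j , code-strong-epi (s j) (s i) below

hom-good : ∀ N (s : ℕ → 𝒯 N) → Good (HomOrder N) s
hom-good N s = let i , j , i<j , r = strong-good N s in i , j , i<j , strong⇒hom {a = s i} {s j} r

theorem2p3 : (N : ℕ) → WQO (HomOrder N) × WQO (StrongOrder N)
theorem2p3 N =
    wqo-from-good (HomOrder N) (λ {a} → hom-refl {a = a})
                  (λ {a} {b} {c} → hom-trans {a = a} {b} {c}) (hom-good N)
  , wqo-from-good (StrongOrder N) (λ {a} → strong-refl {a = a})
                  (λ {a} {b} {c} → strong-trans {a = a} {b} {c}) (strong-good N)
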